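{- Let $R$ be a commutative ring with unity, $G=(V,E)$ a finite graph and $\alpha$ an edge labeling of $G$ over $R$. If $uv$ is an edge such that the ideal $\alpha(uv)$ contains $\alpha(e)$ for every edge $e$ of $G$, and $G-\{uv\}$ is connected, then $S(G)=S(G-\{uv\})$ (where $G-\{uv\}$ carries the restriction of $\alpha$). In particular, if $\alpha(uv)=(1)=R$, then $S(G)=S(G-\{uv\})$, without requiring $G-\{uv\}$ to be connected.
   Context: An edge labeling of a graph $G=(V,E)$ over a commutative ring $R$ with unity is a function $\alpha:E\to I(R)$, where $I(R)$ is the set of ideals of $R$. A spline on $(G,\alpha)$ is a function $p:V\to R$ such that $p(u)-p(v)\in\alpha(uv)$ for every edge $uv$. $S(G)=S_R(G,\alpha)$ denotes the set of all splines on $(G,\alpha)$; it is a ring and an $R$-module under pointwise operations. -}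

module Defs where

open import Level using (Level; _⊔_; suc)
open import Algebra.Bundles using (CommutativeRing)
open import Data.Nat using (ℕ)
open import Data.Fin using (Fin)
open import Data.Product using (_×_)
open import Data.Sum using (_⊎_)
open import Relation.Binary.PropositionalEquality using (_≡_; _≢_)

record Ideal {c ℓ} (R : CommutativeRing c ℓ) (ℓi : Level) : Set (c ⊔ ℓ ⊔ suc ℓi) where
  open CommutativeRing R
  field
    _∈I      : Carrier → Set ℓi
    ∈-resp-≈ : ∀ {x y} → x ≈ y → x ∈I → y ∈I
    0∈       : 0# ∈I
    +-closed : ∀ {x y} → x ∈I → y ∈I → (x + y) ∈I
    *-closed : ∀ r {x} → x ∈I → (r * x) ∈I
open Ideal public

record Graph : Set where
  field
    n m      : ℕ
    src tgt  : Fin m → Fin n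
    loopless : ∀ e → src e ≢ tgt e
    simple   : ∀ e e' → (src e ≡ src e' × tgt e ≡ tgt e') ⊎ (src e ≡ tgt e' × tgt e ≡ src e') → e ≡ e'
open Graph public

EdgeLabeling : ∀ {c ℓ} (R : CommutativeRing c ℓ) (ℓi : Level) → Graph → Set (c ⊔ ℓ ⊔ suc ℓi)
EdgeLabeling R ℓi G = Fin (m G) → Ideal R ℓi

module _ {c ℓ ℓi} (R : CommutativeRing c ℓ) (G : Graph) (α : EdgeLabeling R ℓi G) where
  open CommutativeRing R

  IsSpline : (Fin (n G) → Carrier) → Set ℓi
  IsSpline p = ∀ e → _∈I (α e) (p (src G e) - p (tgt G e))

  IsSplineDel : Fin (m G) → (Fin (n G) → Carrier) → Set ℓi
  IsSplineDel d p = ∀ e → e ≢ d → _∈I (α e) (p (src G e) - p (tgt G e))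

data WalkDel (G : Graph) (d : Fin (m G)) : Fin (n G) → Fin (n G) → Set where
  here : ∀ {x} → WalkDel G d x x
  fwd  : ∀ {y} e → e ≢ d → WalkDel G d (tgt G e) y → WalkDel G d (src G e) y
  bwd  : ∀ {y} e → e ≢ d → WalkDel G d (src G e) y → WalkDel G d (tgt G e) y

ConnectedDel : (G : Graph) → Fin (m G) → Set
ConnectedDel G d = ∀ x y → WalkDel G d x y

-- Congruence modulo an ideal is an equivalence relation, so along any walk in G - {uv}
-- a spline's values are congruent modulo every ideal containing the labels of the walk's
-- edges. If α(uv) contains all labels and G - {uv} connects u to v, the condition at uv is
-- therefore implied by the others; if α(uv) = R it holds trivially.
module Submission where

open import Defs
open import Algebra.Bundles using (CommutativeRing)
import Algebra.Properties.AbelianGroup as AbelianGroupProperties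
import Algebra.Properties.Ring as RingProperties
open import Data.Fin using (Fin)
open import Data.Fin.Properties using (_≟_)
open import Data.Product using (_×_; _,_)
open import Function.Bundles using (_⇔_; mk⇔)
open import Relation.Binary.PropositionalEquality using (refl; _≢_)
import Relation.Binary.Reasoning.Setoid as SetoidReasoning
open import Relation.Nullary using (yes; no)

module _ {c ℓ} {R : CommutativeRing c ℓ} where
  open CommutativeRing R
  open AbelianGroupProperties +-abelianGroup using (⁻¹-anti-homo‿-)
  open RingProperties ring using (-1*x≈-x)
  open SetoidReasoning setoid

  _≡_[mod_] : ∀ {ℓi} → Carrier → Carrier → Ideal R ℓi → Set ℓi
  x ≡ y [mod I ] = _∈I I (x - y)

  module _ {ℓi} (I : Ideal R ℓi) where

    -‿closed : ∀ {x} → _∈I I x → _∈I I (- x)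
    -‿closed {x} x∈I = ∈-resp-≈ I (-1*x≈-x x) (*-closed I (- 1#) x∈I)

    mod-refl : ∀ x → x ≡ x [mod I ]
    mod-refl x = ∈-resp-≈ I (sym (-‿inverseʳ x)) (0∈ I)

    mod-sym : ∀ {x y} → x ≡ y [mod I ] → y ≡ x [mod I ]
    mod-sym {x} {y} x≡y = ∈-resp-≈ I (⁻¹-anti-homo‿- x y) (-‿closed x≡y)

    mod-trans : ∀ {x y z} → x ≡ y [mod I ] → y ≡ z [mod I ] → x ≡ z [mod I ]
    mod-trans {x} {y} {z} x≡y y≡z = ∈-resp-≈ I telescope (+-closed I x≡y y≡z)
      where
      telescope : (x - y) + (y - z) ≈ x - z
      telescope = begin
        (x - y) + (y - z)    ≈⟨ +-assoc x (- y) (y - z) ⟩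
        x + (- y + (y - z))  ≈⟨ +-congˡ (sym (+-assoc (- y) y (- z))) ⟩
        x + ((- y + y) - z)  ≈⟨ +-congˡ (+-congʳ (-‿inverseˡ y)) ⟩
        x + (0# - z)         ≈⟨ +-congˡ (+-identityˡ (- z)) ⟩
        x - z                ∎

module _ {c ℓ ℓi} (R : CommutativeRing c ℓ) (G : Graph) (α : EdgeLabeling R ℓi G) (d : Fin (m G)) where
  open CommutativeRing R using (Carrier)

  spline⇔splineDel : ∀ (p : Fin (n G) → Carrier)
    → (IsSplineDel R G α d p → p (src G d) ≡ p (tgt G d) [mod α d ])
    → IsSpline R G α p ⇔ IsSplineDel R G α d p
  spline⇔splineDel p condition-at-d = mk⇔ (λ s e _ → s e) splineDel⇒spline
    where
    splineDel⇒spline : IsSplineDel R G α d p → IsSpline R G α p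
    splineDel⇒spline s e with e ≟ d
    ... | yes refl = condition-at-d s
    ... | no e≢d   = s e e≢d

  splineDel-walk : ∀ {ℓj} (J : Ideal R ℓj) → (∀ e → e ≢ d → ∀ x → _∈I (α e) x → _∈I J x)
    → ∀ (p : Fin (n G) → Carrier) → IsSplineDel R G α d p
    → ∀ {x y} → WalkDel G d x y → p x ≡ p y [mod J ]
  splineDel-walk J α⊆J p s here           = mod-refl J (p _)
  splineDel-walk J α⊆J p s (fwd e e≢d w) =
    mod-trans J (α⊆J e e≢d _ (s e e≢d)) (splineDel-walk J α⊆J p s w)
  splineDel-walk J α⊆J p s (bwd e e≢d w) =
    mod-trans J (mod-sym J (α⊆J e e≢d _ (s e e≢d))) (splineDel-walk J α⊆J p s w)

lemma2p3 : ∀ {c ℓ ℓi} (R : CommutativeRing c ℓ) (G : Graph) (α : EdgeLabeling R ℓi G) (uv : Fin (m G))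
    → ((∀ e x → _∈I (α e) x → _∈I (α uv) x) → ConnectedDel G uv
         → ∀ (p : Fin (n G) → CommutativeRing.Carrier R) → IsSpline R G α p ⇔ IsSplineDel R G α uv p)
    × ((∀ x → _∈I (α uv) x)
         → ∀ (p : Fin (n G) → CommutativeRing.Carrier R) → IsSpline R G α p ⇔ IsSplineDel R G α uv p)
lemma2p3 R G α uv = dominant , unit
  where
  dominant : (∀ e x → _∈I (α e) x → _∈I (α uv) x) → ConnectedDel G uv
    → ∀ p → IsSpline R G α p ⇔ IsSplineDel R G α uv p
  dominant α⊆αuv connected p = spline⇔splineDel R G α uv p λ s →
    splineDel-walk R G α uv (α uv) (λ e _ → α⊆αuv e) p s (connected (src G uv) (tgt G uv))

  unit : (∀ x → _∈I (α uv) x) → ∀ p → IsSpline R G α p ⇔ IsSplineDel R G α uv p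
  unit αuv≡R p = spline⇔splineDel R G α uv p λ _ → αuv≡R _
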